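{- Let $k,h,n_1,\dots,n_k$ be positive integers such that for every $1\le i\le k$, $n_i$ divides $\gcd(h,n_i)^2$ and $(\nu_2(n_i),\nu_2(h))\neq(1,1)$. Then a perfect $h$-phase array of size $n_1\times\cdots\times n_k$ exists.
   Context: $\nu_2(x)$ is the $2$-adic valuation of $x$. A perfect $h$-phase array of size $n_1\times\cdots\times n_k$ is an array $A=(a_{i_1,\dots,i_k})_{0\le i_j\le n_j-1}$ of complex $h$th roots of unity such that $\sum_{0\le i_j\le n_j-1\ \forall j} a_{i_1,\dots,i_k}\overline{a_{i_1+s_1,\dots,i_k+s_k}}=0$ for every $(s_1,\dots,s_k)\neq(0,\dots,0)$, indices taken modulo $n_j$. -}

module Defs where

open import Level using (0ℓ)
open import Data.Nat using (ℕ; zero; suc; _∸_; _%_; _/_; _<_; _≤_)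
import Data.Nat as ℕ
open import Data.Nat.DivMod using (m%n<n)
open import Data.Fin using (Fin; toℕ; fromℕ<)
import Data.Fin as Fin
open import Data.Product using (_×_; Σ)
open import Relation.Nullary using (¬_)
open import Relation.Binary.PropositionalEquality using (_≡_)
open import Algebra.Bundles using (CommutativeRing)

-- 2-adic valuation ν₂ (with fuel n, which suffices for n ≥ 1; ν₂ 0 = 0
-- is an irrelevant convention since the theorem only uses n ≥ 1).

ν₂-fuel : ℕ → ℕ → ℕ
ν₂-fuel zero    m       = 0
ν₂-fuel (suc f) zero    = 0
ν₂-fuel (suc f) (suc m) with suc m % 2
... | zero  = suc (ν₂-fuel f (suc m / 2))
... | suc _ = 0

ν₂ : ℕ → ℕ
ν₂ n = ν₂-fuel n n

Index : (k : ℕ) → (Fin k → ℕ) → Set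
Index k n = (i : Fin k) → Fin (n i)

_+ₘ_ : ∀ {m} → Fin m → Fin m → Fin m
_+ₘ_ {suc m} a b = fromℕ< (m%n<n (toℕ a ℕ.+ toℕ b) (suc m))

shift : ∀ {k} {n : Fin k → ℕ} → Index k n → Index k n → Index k n
shift i s j = i j +ₘ s j

-- An h-phase array: entry e : Fin h stands for the h-th root of unity ζ^e,
-- ζ a primitive h-th root of unity (every h-th root of unity is uniquely such).
Array : (h k : ℕ) → (Fin k → ℕ) → Set
Array h k n = Index k n → Fin h

module _ (R : CommutativeRing 0ℓ 0ℓ) where
  open CommutativeRing R

  pow : Carrier → ℕ → Carrier
  pow x zero    = 1#
  pow x (suc m) = x * pow x m

  natCast : ℕ → Carrier
  natCast zero    = 0#
  natCast (suc m) = 1# + natCast m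

  sumFin : (m : ℕ) → (Fin m → Carrier) → Carrier
  sumFin zero    f = 0#
  sumFin (suc m) f = f Fin.zero + sumFin m (λ j → f (Fin.suc j))

  sumIndex : (k : ℕ) (n : Fin k → ℕ) → (Index k n → Carrier) → Carrier
  sumIndex zero    n f = f (λ ())
  sumIndex (suc k) n f =
    sumFin (n Fin.zero) (λ j →
      sumIndex k (λ i → n (Fin.suc i)) (λ t → f (λ { Fin.zero → j ; (Fin.suc i) → t i })))

  IsChar0Domain : Set
  IsChar0Domain =
    (∀ x y → x * y ≈ 0# → (x ≈ 0#) Data.Sum.⊎ (y ≈ 0#)) ×
    (∀ m → ¬ (natCast (suc m) ≈ 0#))
    where import Data.Sum

  IsPrimitiveRoot : ℕ → Carrier → Set
  IsPrimitiveRoot h ζ = (pow ζ h ≈ 1#) × (∀ d → 0 < d → d < h → ¬ (pow ζ d ≈ 1#))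

  -- periodic autocorrelation of A at shift s, computed in R with root ζ:
  --   Σ_i ζ^{A i} · conj(ζ^{A (i+s)}),  where conj(ζ^e) = ζ^{-e} = ζ^{h-e}
  autocorr : (h k : ℕ) (n : Fin k → ℕ) → Carrier → Array h k n → Index k n → Carrier
  autocorr h k n ζ A s =
    sumIndex k n (λ i → pow ζ (toℕ (A i)) * pow ζ (h ∸ toℕ (A (shift i s))))

-- Complex numbers are not available; instead the
-- autocorrelation (a ℤ-combination of h-th roots of unity) is required to
-- vanish in every characteristic-0 integral domain for every primitive h-th
-- root of unity ζ.  Since the minimal polynomial over ℚ of any primitive
-- h-th root of unity in such a domain is the cyclotomic polynomial Φ_h, this
-- is equivalent to vanishing in ℂ with ζ = e^{2πi/h}.

IsZeroShift : ∀ {k} {n : Fin k → ℕ} → Index k n → Set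
IsZeroShift {k} s = ∀ (j : Fin k) → toℕ (s j) ≡ 0

IsPerfect : (h k : ℕ) (n : Fin k → ℕ) → Array h k n → Set₁
IsPerfect h k n A =
  (R : CommutativeRing 0ℓ 0ℓ) → IsChar0Domain R →
  (ζ : CommutativeRing.Carrier R) → IsPrimitiveRoot R h ζ →
  (s : Index k n) → ¬ IsZeroShift {k} {n} s →
  CommutativeRing._≈_ R (autocorr R h k n ζ A s) (CommutativeRing.0# R)

{-# OPTIONS --safe #-}
module Submission where

-- If a is a perfect sequence of length n₁ and B a perfect array of size n₂ × ⋯ × nₖ, then
-- (x , y) ↦ a x · B y is perfect: its autocorrelation at (s₁ , s′) is the product of the
-- autocorrelations of a at s₁ and of B at s′. So it suffices to build perfect sequences.
--
-- A sequence x ↦ ζ^(e x) of length N is perfect as soon as e is N-periodic modulo h and every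
-- shift 0 < σ < N has an offset t and a defect d with h ∤ d and
-- e (x + t) + e (x + σ) + d = e x + e (x + σ + t): substituting x ↦ x + t in the
-- autocorrelation sum S gives S ζ^d = S, hence S = 0 because ζ^d ≠ 1 in a domain.
--
-- With g = gcd h N, the hypothesis N ∣ g² gives N = m L² and h = α m L. The exponent
-- e x = α Σ_{y<x} ⌊y/L⌋ + β ⌊x/L⌋ cancels σ with t = L, d = α σ when m L ∤ σ, and with
-- t = 1, d = α σ / L otherwise. It is N-periodic modulo h iff h ∣ m L β + α L T(m L),
-- T the triangular numbers, which holds for β = 0 or β = α/2 unless L is odd, m even and
-- α odd. Then m ≡ 2 (mod 4) would give ν₂ N = ν₂ h = 1, and m ≡ 0 (mod 4) lets us rewrite
-- N = (m/4)(2L)² and h = 2α (m/4)(2L) with 2L even.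

open import Defs
open import Data.Nat using (ℕ; _≤_; _^_)
open import Data.Nat.Divisibility using (_∣_)
open import Data.Nat.GCD using (gcd)
open import Data.Fin using (Fin)
open import Data.Product using (_×_; Σ)
open import Relation.Nullary using (¬_)
open import Relation.Binary.PropositionalEquality using (_≡_)

open import Level using (0ℓ)
open import Algebra.Bundles using (CommutativeRing)
open import Data.Nat as ℕ using (zero; suc; _∸_; NonZero)
import Data.Nat.Properties as ℕ
open import Data.Nat.DivMod using (_mod_; _%_; m%n<n; m%n≤n; m≡m%n+[m/n]*n; [m+kn]%n≡m%n)
open import Data.Nat.Divisibility using (m%n≡0⇒n∣m)
open import Data.Fin using (zero; suc; toℕ; inject₁; fromℕ)
open import Data.Fin.Properties using (toℕ-inject₁; toℕ-fromℕ; toℕ-fromℕ<; toℕ<n)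
open import Data.Product using (_,_; proj₁; proj₂)
open import Data.Sum using (inj₁; inj₂)
open import Function using (_∘_)
open import Relation.Nullary using (Dec; contradiction; yes; no)
open import Relation.Binary.PropositionalEquality using (_≢_)
import Relation.Binary.PropositionalEquality as ≡

module Exponents where
  open import Data.Nat.Base
  open import Data.Nat.Properties
  open import Data.Nat.DivMod
  open import Data.Nat.Divisibility
  open import Data.Nat.GCD using (gcd[m,n]∣m; gcd[m,n]∣n; gcd[m,n]≢0)
  open import Data.Nat.Tactic.RingSolver using (solve-∀)
  open import Data.Product using (∃-syntax)
  open import Data.Sum using (_⊎_)
  open import Relation.Binary.PropositionalEquality

  periodic-% : ∀ {A : Set} {N} .{{_ : NonZero N}} (f : ℕ → A) →
               (∀ y → f (y + N) ≡ f y) → ∀ y → f (y % N) ≡ f y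
  periodic-% {N = N} f periodic y = begin
    f (y % N)                   ≡⟨ periodic-+* (y / N) (y % N) ⟨
    f (y % N + (y / N) * N)     ≡⟨ cong f (m≡m%n+[m/n]*n y N) ⟨
    f y                         ∎
    where
    open ≡-Reasoning
    periodic-+* : ∀ q x → f (x + q * N) ≡ f x
    periodic-+* zero    x = cong f (+-identityʳ x)
    periodic-+* (suc q) x = trans (cong f (trans (cong (x +_) (+-comm N (q * N))) (sym (+-assoc x (q * N) N))))
                                  (trans (periodic (x + q * N)) (periodic-+* q x))

  record Cancellation (h : ℕ) (e : ℕ → ℕ) (σ : ℕ) : Set where
    field
      offset defect : ℕ
      defect-indivisible : ¬ h ∣ defect
      identity : ∀ x → e (x + offset) + e (x + σ) + defect ≡ e x + e (x + σ + offset)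

  record PerfectExponent (N h : ℕ) : Set where
    field
      exponent : ℕ → ℕ
      periodic : ∀ x → ∃[ p ] exponent (x + N) ≡ exponent x + p * h
      cancellation : ∀ {σ} → 0 < σ → σ < N → Cancellation h exponent σ

  triangle : ℕ → ℕ
  triangle zero    = 0
  triangle (suc m) = triangle m + m

  2*triangle : ∀ m → 2 * triangle m ≡ m * (m ∸ 1)
  2*triangle zero          = refl
  2*triangle (suc zero)    = refl
  2*triangle (suc (suc m)) = begin
    2 * (triangle (suc m) + suc m)     ≡⟨ *-distribˡ-+ 2 (triangle (suc m)) (suc m) ⟩
    2 * triangle (suc m) + 2 * suc m   ≡⟨ cong (_+ 2 * suc m) (2*triangle (suc m)) ⟩
    suc m * m + 2 * suc m              ≡⟨ expand m ⟩
    suc (suc m) * suc m                ∎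
    where
    open ≡-Reasoning
    expand : ∀ m → suc m * m + 2 * suc m ≡ suc (suc m) * suc m
    expand = solve-∀

  module Quadratic (L α β : ℕ) .{{_ : NonZero L}} where

    floorSum : ℕ → ℕ
    floorSum zero    = 0
    floorSum (suc x) = floorSum x + x / L

    exponent : ℕ → ℕ
    exponent x = α * floorSum x + β * (x / L)

    [x+u*L]/L : ∀ x u → (x + u * L) / L ≡ x / L + u
    [x+u*L]/L x u = trans (+-distrib-/-∣ʳ x (n∣m*n u)) (cong (x / L +_) (m*n/n≡m u L))

    [x+L]/L : ∀ x → (x + L) / L ≡ x / L + 1
    [x+L]/L x = trans (cong (λ y → (x + y) / L) (sym (*-identityˡ L))) ([x+u*L]/L x 1)

    floorSum-≤L : ∀ {y} → y ≤ L → floorSum y ≡ 0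
    floorSum-≤L {zero}  _   = refl
    floorSum-≤L {suc y} y<L = cong₂ _+_ (floorSum-≤L (<⇒≤ y<L)) (m<n⇒m/n≡0 y<L)

    floorSum-+L : ∀ x → floorSum (x + L) ≡ floorSum x + x
    floorSum-+L zero    = floorSum-≤L ≤-refl
    floorSum-+L (suc x) rewrite floorSum-+L x | [x+L]/L x = regroup (floorSum x) x (x / L)
      where
      regroup : ∀ Φ x q → Φ + x + (q + 1) ≡ Φ + q + suc x
      regroup = solve-∀

    exponent-+L : ∀ x → exponent (x + L) ≡ exponent x + α * x + β
    exponent-+L x rewrite floorSum-+L x | [x+L]/L x = regroup α β (floorSum x) x (x / L)
      where
      regroup : ∀ α β Φ x q → α * (Φ + x) + β * (q + 1) ≡ α * Φ + β * q + α * x + β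
      regroup = solve-∀

    exponent-+*L : ∀ k x → exponent (x + k * L) ≡ exponent x + k * (α * x + β) + α * L * triangle k
    exponent-+*L zero    x rewrite +-identityʳ x = regroup (exponent x) α L
      where
      regroup : ∀ E α L → E ≡ E + 0 + α * L * 0
      regroup = solve-∀
    exponent-+*L (suc k) x
      rewrite +-comm L (k * L) | sym (+-assoc x (k * L) L) | exponent-+L (x + k * L) | exponent-+*L k x =
      regroupʳ (exponent x) k α x β L (triangle k)
      where
      regroupʳ : ∀ E k α x β L T → E + k * (α * x + β) + α * L * T + α * (x + k * L) + β
                                   ≡ E + suc k * (α * x + β) + α * L * (T + k)
      regroupʳ = solve-∀

    cancellation-by-L : ∀ σ x → exponent (x + L) + exponent (x + σ) + α * σ ≡ exponent x + exponent (x + σ + L)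
    cancellation-by-L σ x rewrite exponent-+L x | exponent-+L (x + σ) = regroup (exponent x) (exponent (x + σ)) α x β σ
      where
      regroup : ∀ E E′ α x β σ → E + α * x + β + E′ + α * σ ≡ E + (E′ + α * (x + σ) + β)
      regroup = solve-∀

    cancellation-by-1 : ∀ u x → exponent (x + 1) + exponent (x + u * L) + α * u ≡ exponent x + exponent (x + u * L + 1)
    cancellation-by-1 u x rewrite +-comm x 1 | +-comm (x + u * L) 1 | [x+u*L]/L x u | [x+u*L]/L (suc x) u =
      regroup α β (floorSum x) (floorSum (x + u * L)) (x / L) (suc x / L) u
      where
      regroup : ∀ α β Φ Φ′ q q′ u → α * (Φ + q) + β * q′ + (α * Φ′ + β * (q + u)) + α * u
                                    ≡ α * Φ + β * q + (α * (Φ′ + (q + u)) + β * (q′ + u))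
      regroup = solve-∀

  quadraticExponent : ∀ L m α β .{{_ : NonZero L}} .{{_ : NonZero (α * (m * L))}} →
    α * (m * L) ∣ m * L * β + α * L * triangle (m * L) →
    PerfectExponent (m * L * L) (α * (m * L))
  quadraticExponent L m α β {{_}} {{h≢0}} (divides c X≡c*h) = record
    { exponent = exponent ; periodic = periodic ; cancellation = cancellation }
    where
    open Quadratic L α β
    M = m * L
    h = α * M

    instance
      α≢0 : NonZero α
      α≢0 = m*n≢0⇒m≢0 α {{h≢0}}
      m≢0 : NonZero m
      m≢0 = m*n≢0⇒m≢0 m {{m*n≢0⇒n≢0 α {{h≢0}}}}

    periodic : ∀ x → ∃[ p ] exponent (x + M * L) ≡ exponent x + p * h
    periodic x = x + c , (begin
      exponent (x + M * L)                                ≡⟨ exponent-+*L M x ⟩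
      exponent x + M * (α * x + β) + α * L * triangle M   ≡⟨ regroup (exponent x) M α x β _ ⟩
      exponent x + x * h + (M * β + α * L * triangle M)   ≡⟨ cong (exponent x + x * h +_) X≡c*h ⟩
      exponent x + x * h + c * h                          ≡⟨ +-assoc (exponent x) _ _ ⟩
      exponent x + (x * h + c * h)                        ≡⟨ cong (exponent x +_) (*-distribʳ-+ h x c) ⟨
      exponent x + (x + c) * h                            ∎)
      where
      open ≡-Reasoning
      regroup : ∀ E M α x β Y → E + M * (α * x + β) + Y ≡ E + x * (α * M) + (M * β + Y)
      regroup = solve-∀

    cancellation : ∀ {σ} → 0 < σ → σ < M * L → Cancellation h exponent σ
    cancellation {σ} 0<σ σ<N with M ∣? σ
    ... | no M∤σ = record
      { offset             = L
      ; defect             = α * σ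
      ; defect-indivisible = λ h∣ασ → M∤σ (*-cancelˡ-∣ α h∣ασ)
      ; identity           = cancellation-by-L σ
      }
    ... | yes (divides j refl) = record
      { offset             = 1
      ; defect             = α * (m * j)
      ; defect-indivisible = >⇒∤ {{m*n≢0 α (m * j) {{α≢0}} {{m*n≢0 m j}}}} (*-monoʳ-< α (*-monoʳ-< m j<L))
      ; identity           = λ x → subst (λ σ → exponent (x + 1) + exponent (x + σ) + α * (m * j)
                                                  ≡ exponent x + exponent (x + σ + 1))
                                         (regroup m j L) (cancellation-by-1 (m * j) x)
      }
      where
      instance
        j≢0 : NonZero j
        j≢0 = m*n≢0⇒m≢0 j {{>-nonZero 0<σ}}
      j<L : j < L
      j<L = *-cancelʳ-< M j L (subst (j * M <_) (*-comm M L) σ<N)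
      regroup : ∀ m j L → m * j * L ≡ j * (m * L)
      regroup = solve-∀

  Odd : ℕ → Set
  Odd n = ∃[ a ] n ≡ 2 * a + 1

  even-or-odd : ∀ n → 2 ∣ n ⊎ Odd n
  even-or-odd zero = inj₁ (2 ∣0)
  even-or-odd (suc n) with even-or-odd n
  ... | inj₁ (divides a refl) = inj₂ (a , trans (+-comm 1 (a * 2)) (cong (_+ 1) (*-comm a 2)))
  ... | inj₂ (a , refl)      = inj₁ (divides (suc a) (regroup a))
    where
    regroup : ∀ a → suc (2 * a + 1) ≡ suc a * 2
    regroup = solve-∀

  odd*odd : ∀ {m n} → Odd m → Odd n → Odd (m * n)
  odd*odd (a , refl) (b , refl) = 2 * a * b + a + b , expand a b
    where
    expand : ∀ a b → (2 * a + 1) * (2 * b + 1) ≡ 2 * (2 * a * b + a + b) + 1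
    expand = solve-∀

  odd⇒2∣pred : ∀ {m} → Odd m → 2 ∣ m ∸ 1
  odd⇒2∣pred (a , refl) = divides a (trans (m+n∸n≡m (2 * a) 1) (*-comm 2 a))

  even⇒odd-pred : ∀ {m} .{{_ : NonZero m}} → 2 ∣ m → Odd (m ∸ 1)
  even⇒odd-pred {suc _} (divides (suc a) eq) = a , suc-injective (trans eq (regroup a))
    where
    regroup : ∀ a → suc a * 2 ≡ suc (2 * a + 1)
    regroup = solve-∀

  ν₂-fuel-double : ∀ f k → ν₂-fuel (suc f) (suc k * 2) ≡ suc (ν₂-fuel f (suc k))
  ν₂-fuel-double f k rewrite m*n%n≡0 (suc k) 2 {{_}} | m*n/n≡m (suc k) 2 {{_}} = refl

  ν₂-fuel-odd : ∀ f k → ν₂-fuel f (suc (k * 2)) ≡ 0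
  ν₂-fuel-odd zero    k = refl
  ν₂-fuel-odd (suc f) k rewrite [m+kn]%n≡m%n 1 k 2 {{_}} = refl

  ν₂[2*odd]≡1 : ∀ {m} → Odd m → ν₂ (2 * m) ≡ 1
  ν₂[2*odd]≡1 (a , refl) rewrite *-comm 2 (2 * a + 1) | +-comm (2 * a) 1 | *-comm 2 a =
    trans (ν₂-fuel-double _ (a * 2)) (cong suc (ν₂-fuel-odd _ a))

  periodicity-condition-even : ∀ L M α → 2 ∣ L * (M ∸ 1) → α * M ∣ M * 0 + α * L * triangle M
  periodicity-condition-even L M α 2∣L[M-1] rewrite *-zeroʳ M =
    *-cancelˡ-∣ 2 (subst₂ _∣_ (*-comm (α * M) 2) α*M*L[M-1]≡2*X (*-monoʳ-∣ (α * M) 2∣L[M-1]))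
    where
    open ≡-Reasoning
    α*M*L[M-1]≡2*X : α * M * (L * (M ∸ 1)) ≡ 2 * (α * L * triangle M)
    α*M*L[M-1]≡2*X = begin
      α * M * (L * (M ∸ 1))     ≡⟨ regroup α M L (M ∸ 1) ⟩
      α * L * (M * (M ∸ 1))     ≡⟨ cong (α * L *_) (2*triangle M) ⟨
      α * L * (2 * triangle M)  ≡⟨ *-comm (α * L) _ ⟩
      2 * triangle M * (α * L)  ≡⟨ regroup′ 2 (triangle M) α L ⟩
      2 * (α * L * triangle M)  ∎
      where
      regroup : ∀ α M L p → α * M * (L * p) ≡ α * L * (M * p)
      regroup = solve-∀
      regroup′ : ∀ a t α L → a * t * (α * L) ≡ a * (α * L * t)
      regroup′ = solve-∀

  periodicity-condition-odd : ∀ L M c → Odd (L * (M ∸ 1)) → c * 2 * M ∣ M * c + c * 2 * L * triangle M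
  periodicity-condition-odd L M c (w , L[M-1]≡2w+1) = divides (w + 1) (begin
    M * c + c * 2 * L * triangle M      ≡⟨ regroup M c L (triangle M) ⟩
    M * c + c * L * (2 * triangle M)    ≡⟨ cong (λ t → M * c + c * L * t) (2*triangle M) ⟩
    M * c + c * L * (M * (M ∸ 1))       ≡⟨ regroup′ M c L (M ∸ 1) ⟩
    M * c + c * M * (L * (M ∸ 1))       ≡⟨ cong (λ t → M * c + c * M * t) L[M-1]≡2w+1 ⟩
    M * c + c * M * (2 * w + 1)         ≡⟨ regroup″ M c w ⟩
    (w + 1) * (c * 2 * M)               ∎)
    where
    open ≡-Reasoning
    regroup : ∀ M c L t → M * c + c * 2 * L * t ≡ M * c + c * L * (2 * t)
    regroup = solve-∀
    regroup′ : ∀ M c L p → M * c + c * L * (M * p) ≡ M * c + c * M * (L * p)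
    regroup′ = solve-∀
    regroup″ : ∀ M c w → M * c + c * M * (2 * w + 1) ≡ (w + 1) * (c * 2 * M)
    regroup″ = solve-∀

  perfectExponent-factored : ∀ L m α .{{_ : NonZero L}} .{{_ : NonZero (α * (m * L))}} →
    ¬ (ν₂ (m * L * L) ≡ 1 × ν₂ (α * (m * L)) ≡ 1) → PerfectExponent (m * L * L) (α * (m * L))
  perfectExponent-factored L m α {{_}} {{h≢0}} ν₂≢1 with even-or-odd L | even-or-odd m | even-or-odd α
  ... | inj₁ 2∣L | _ | _ =
    quadraticExponent L m α 0 (periodicity-condition-even L (m * L) α (∣m⇒∣m*n (m * L ∸ 1) 2∣L))
  ... | inj₂ L-odd | inj₂ m-odd | _ =
    quadraticExponent L m α 0 (periodicity-condition-even L (m * L) α (∣n⇒∣m*n L (odd⇒2∣pred (odd*odd m-odd L-odd))))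
  ... | inj₂ L-odd | inj₁ 2∣m | inj₁ (divides c refl) =
    quadraticExponent L m (c * 2) c
      (periodicity-condition-odd L (m * L) c
        (odd*odd L-odd (even⇒odd-pred {{m*n≢0⇒n≢0 (c * 2) {{h≢0}}}} (∣m⇒∣m*n L 2∣m))))
  ... | inj₂ L-odd | inj₁ (divides q refl) | inj₂ α-odd with even-or-odd q
  ...   | inj₁ (divides b refl) =
    subst₂ PerfectExponent (regroupN b L) (regroupH α b L)
      (quadraticExponent (2 * L) b (2 * α) 0 {{m*n≢0 2 L}} {{subst NonZero (sym (regroupH α b L)) h≢0}}
        (periodicity-condition-even (2 * L) (b * (2 * L)) (2 * α) (∣m⇒∣m*n (b * (2 * L) ∸ 1) (m∣m*n L))))
    where
    regroupN : ∀ b L → b * (2 * L) * (2 * L) ≡ b * 2 * 2 * L * L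
    regroupN = solve-∀
    regroupH : ∀ α b L → 2 * α * (b * (2 * L)) ≡ α * (b * 2 * 2 * L)
    regroupH = solve-∀
  ...   | inj₂ q-odd = contradiction
    ( subst (λ n → ν₂ n ≡ 1) (regroupN q L) (ν₂[2*odd]≡1 (odd*odd q-odd (odd*odd L-odd L-odd)))
    , subst (λ n → ν₂ n ≡ 1) (regroupH α q L) (ν₂[2*odd]≡1 (odd*odd α-odd (odd*odd q-odd L-odd))) )
    ν₂≢1
    where
    regroupN : ∀ q L → 2 * (q * (L * L)) ≡ q * 2 * L * L
    regroupN = solve-∀
    regroupH : ∀ α q L → 2 * (α * (q * L)) ≡ α * (q * 2 * L)
    regroupH = solve-∀

  square-divisor-factorisation : ∀ N h .{{_ : NonZero h}} → N ∣ gcd h N ^ 2 →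
    ∃[ L ] ∃[ m ] ∃[ α ] N ≡ m * L * L × h ≡ α * (m * L)
  square-divisor-factorisation N h (divides m g²≡m*N) = decompose (gcd[m,n]∣n h N) (gcd[m,n]∣m h N)
    where
    g = gcd h N
    decompose : g ∣ N → g ∣ h → ∃[ L ] ∃[ m ] ∃[ α ] N ≡ m * L * L × h ≡ α * (m * L)
    decompose (divides L N≡L*g) (divides α h≡α*g) =
      L , m , α , trans N≡L*g (trans (cong (L *_) g≡m*L) (*-comm L (m * L))) , trans h≡α*g (cong (α *_) g≡m*L)
      where
      open ≡-Reasoning
      g≡m*L : g ≡ m * L
      g≡m*L = *-cancelʳ-≡ g (m * L) g {{≢-nonZero (gcd[m,n]≢0 h N (inj₁ (≢-nonZero⁻¹ h)))}} (begin
        g * g          ≡⟨ cong (g *_) (*-identityʳ g) ⟨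
        g ^ 2          ≡⟨ g²≡m*N ⟩
        m * N          ≡⟨ cong (m *_) N≡L*g ⟩
        m * (L * g)    ≡⟨ *-assoc m L g ⟨
        m * L * g      ∎)

  perfectExponent : ∀ {N h} .{{_ : NonZero N}} .{{_ : NonZero h}} →
    N ∣ gcd h N ^ 2 → ¬ (ν₂ N ≡ 1 × ν₂ h ≡ 1) → PerfectExponent N h
  perfectExponent {N} {h} N∣g² ν₂≢1 with square-divisor-factorisation N h N∣g²
  ... | L , m , α , refl , refl = perfectExponent-factored L m α {{m*n≢0⇒n≢0 (m * L)}} ν₂≢1

open Exponents using (Cancellation; PerfectExponent; periodic-%; perfectExponent)

_⊗_ : ∀ {h k} .{{_ : NonZero h}} {n : Fin (suc k) → ℕ} →
      (Fin (n zero) → Fin h) → Array h k (λ i → n (suc i)) → Array h (suc k) n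
(a ⊗ B) i = (toℕ (a (i zero)) ℕ.+ toℕ (B (λ j → i (suc j)))) mod _

exponentSequence : ∀ {N h} .{{_ : NonZero h}} → PerfectExponent N h → Fin N → Fin h
exponentSequence E x = PerfectExponent.exponent E (toℕ x) mod _

toℕ-+ₘ : ∀ {N} .{{_ : NonZero N}} (x y : Fin N) → toℕ (x +ₘ y) ≡ (toℕ x ℕ.+ toℕ y) % N
toℕ-+ₘ {suc N} x y = toℕ-fromℕ< _

module _ (R : CommutativeRing 0ℓ 0ℓ) where
  open CommutativeRing R

  seqAutocorr : (h N : ℕ) → Carrier → (Fin N → Fin h) → Fin N → Carrier
  seqAutocorr h N ζ a σ = sumFin R N (λ x → pow R ζ (toℕ (a x)) * pow R ζ (h ∸ toℕ (a (x +ₘ σ))))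

IsPerfectSequence : (h N : ℕ) → (Fin N → Fin h) → Set₁
IsPerfectSequence h N a =
  (R : CommutativeRing 0ℓ 0ℓ) → IsChar0Domain R →
  (ζ : CommutativeRing.Carrier R) → IsPrimitiveRoot R h ζ →
  (σ : Fin N) → toℕ σ ≢ 0 →
  CommutativeRing._≈_ R (seqAutocorr R h N ζ a σ) (CommutativeRing.0# R)

module Correlation (R : CommutativeRing 0ℓ 0ℓ) where
  open CommutativeRing R hiding (zero)
  open import Relation.Binary.Reasoning.Setoid setoid
  open import Algebra.Properties.Semiring.Sum semiring
    using (sum; sum-cong-≋; sum-init-last; *-distribˡ-sum; *-distribʳ-sum)
  open import Algebra.Properties.Ring ring using (x[y-z]≈xy-xz)
  open import Algebra.Properties.Group +-group using (x∙y⁻¹≈ε⇒x≈y)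
  open import Algebra.Solver.CommutativeMonoid *-commutativeMonoid using (solve; _⊜_; _⊕_)

  sumFin≡sum : ∀ m (f : Fin m → Carrier) → sumFin R m f ≡ sum f
  sumFin≡sum zero    f = ≡.refl
  sumFin≡sum (suc m) f = ≡.cong (f zero +_) (sumFin≡sum m (f ∘ suc))

  sumFin-cong : ∀ m {f g : Fin m → Carrier} → (∀ j → f j ≈ g j) → sumFin R m f ≈ sumFin R m g
  sumFin-cong m {f} {g} f≈g = begin
    sumFin R m f  ≡⟨ sumFin≡sum m f ⟩
    sum f         ≈⟨ sum-cong-≋ f≈g ⟩
    sum g         ≡⟨ sumFin≡sum m g ⟨
    sumFin R m g  ∎

  *-distribˡ-sumFin : ∀ m c (f : Fin m → Carrier) → c * sumFin R m f ≈ sumFin R m (λ j → c * f j)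
  *-distribˡ-sumFin m c f = begin
    c * sumFin R m f               ≡⟨ ≡.cong (c *_) (sumFin≡sum m f) ⟩
    c * sum f                      ≈⟨ *-distribˡ-sum c f ⟩
    sum (λ j → c * f j)            ≡⟨ sumFin≡sum m _ ⟨
    sumFin R m (λ j → c * f j)     ∎

  *-distribʳ-sumFin : ∀ m c (f : Fin m → Carrier) → sumFin R m f * c ≈ sumFin R m (λ j → f j * c)
  *-distribʳ-sumFin m c f = begin
    sumFin R m f * c               ≡⟨ ≡.cong (_* c) (sumFin≡sum m f) ⟩
    sum f * c                      ≈⟨ *-distribʳ-sum c f ⟩
    sum (λ j → f j * c)            ≡⟨ sumFin≡sum m _ ⟨
    sumFin R m (λ j → f j * c)     ∎

  sumFin-rotate₁ : ∀ N (G : ℕ → Carrier) → G N ≈ G 0 →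
                   sumFin R N (λ x → G (suc (toℕ x))) ≈ sumFin R N (λ x → G (toℕ x))
  sumFin-rotate₁ zero    G _       = refl
  sumFin-rotate₁ (suc m) G GN≈G0 = begin
    sumFin R (suc m) (λ x → G (suc (toℕ x)))                ≡⟨ sumFin≡sum (suc m) (λ x → G (suc (toℕ x))) ⟩
    sum {suc m} (λ x → G (suc (toℕ x)))                     ≈⟨ sum-init-last (λ x → G (suc (toℕ x))) ⟩
    sum {m} (λ x → G (suc (toℕ (inject₁ x)))) + G (suc (toℕ (fromℕ m)))
      ≈⟨ +-cong (sum-cong-≋ {m} (λ x → reflexive (≡.cong (λ y → G (suc y)) (toℕ-inject₁ x))))
                (reflexive (≡.cong (λ y → G (suc y)) (toℕ-fromℕ m))) ⟩
    sum {m} (λ x → G (suc (toℕ x))) + G (suc m)             ≈⟨ +-congˡ GN≈G0 ⟩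
    sum {m} (λ x → G (suc (toℕ x))) + G 0                   ≈⟨ +-comm _ _ ⟩
    G 0 + sum {m} (λ x → G (suc (toℕ x)))                   ≡⟨ ≡.cong (G 0 +_) (sumFin≡sum m _) ⟨
    sumFin R (suc m) (λ x → G (toℕ x))                      ∎

  sumFin-rotate : ∀ N (G : ℕ → Carrier) → (∀ y → G (y ℕ.+ N) ≈ G y) →
                  ∀ t → sumFin R N (λ x → G (toℕ x ℕ.+ t)) ≈ sumFin R N (G ∘ toℕ)
  sumFin-rotate N G periodic zero    = sumFin-cong N (λ x → reflexive (≡.cong G (ℕ.+-identityʳ (toℕ x))))
  sumFin-rotate N G periodic (suc t) = begin
    sumFin R N (λ x → G (toℕ x ℕ.+ suc t))
      ≈⟨ sumFin-cong N (λ x → reflexive (≡.cong G (ℕ.+-suc (toℕ x) t))) ⟩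
    sumFin R N (λ x → G (suc (toℕ x) ℕ.+ t))   ≈⟨ sumFin-rotate₁ N (λ y → G (y ℕ.+ t)) G[N+t]≈G[t] ⟩
    sumFin R N (λ x → G (toℕ x ℕ.+ t))         ≈⟨ sumFin-rotate N G periodic t ⟩
    sumFin R N (G ∘ toℕ)                       ∎
    where
    G[N+t]≈G[t] : G (N ℕ.+ t) ≈ G t
    G[N+t]≈G[t] = trans (reflexive (≡.cong G (ℕ.+-comm N t))) (periodic t)

  sumFin-*-fixed : ∀ N (q : ℕ → Carrier) {z} t →
                   (∀ y → q (y ℕ.+ N) ≈ q y) → (∀ y → q (y ℕ.+ t) * z ≈ q y) →
                   sumFin R N (λ x → q (toℕ x)) * z ≈ sumFin R N (λ x → q (toℕ x))
  sumFin-*-fixed N q {z} t periodic shift-by-t = begin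
    sumFin R N (λ x → q (toℕ x)) * z            ≈⟨ *-congʳ (sumFin-rotate N q periodic t) ⟨
    sumFin R N (λ x → q (toℕ x ℕ.+ t)) * z      ≈⟨ *-distribʳ-sumFin N z _ ⟩
    sumFin R N (λ x → q (toℕ x ℕ.+ t) * z)      ≈⟨ sumFin-cong N (λ x → shift-by-t (toℕ x)) ⟩
    sumFin R N (λ x → q (toℕ x))                ∎

  sumIndex-cong : ∀ k (n : Fin k → ℕ) {f g : Index k n → Carrier} →
                  (∀ i → f i ≈ g i) → sumIndex R k n f ≈ sumIndex R k n g
  sumIndex-cong zero    n f≈g = f≈g _
  sumIndex-cong (suc k) n f≈g = sumFin-cong (n zero) (λ j → sumIndex-cong k (λ i → n (suc i)) (λ t → f≈g _))

  *-distribˡ-sumIndex : ∀ k (n : Fin k → ℕ) c (f : Index k n → Carrier) →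
                        c * sumIndex R k n f ≈ sumIndex R k n (λ i → c * f i)
  *-distribˡ-sumIndex zero    n c f = refl
  *-distribˡ-sumIndex (suc k) n c f = trans (*-distribˡ-sumFin (n zero) c _)
    (sumFin-cong (n zero) (λ j → *-distribˡ-sumIndex k (λ i → n (suc i)) c _))

  pow-+ : ∀ x m n → pow R x (m ℕ.+ n) ≈ pow R x m * pow R x n
  pow-+ x zero    n = sym (*-identityˡ _)
  pow-+ x (suc m) n = trans (*-congˡ (pow-+ x m n)) (sym (*-assoc x _ _))

  inverse-unique : ∀ {x y z} → x * z ≈ 1# → y * z ≈ 1# → x ≈ y
  inverse-unique {x} {y} {z} xz≈1 yz≈1 = begin
    x              ≈⟨ *-identityʳ x ⟨
    x * 1#         ≈⟨ *-congˡ yz≈1 ⟨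
    x * (y * z)    ≈⟨ *-congˡ (*-comm y z) ⟩
    x * (z * y)    ≈⟨ *-assoc x z y ⟨
    x * z * y      ≈⟨ *-congʳ xz≈1 ⟩
    1# * y         ≈⟨ *-identityˡ y ⟩
    y              ∎

  inverse-exchange : ∀ {a b c p q u v} → a * b * c ≈ p * q → u * q ≈ 1# → v * b ≈ 1# → a * u * c ≈ p * v
  inverse-exchange {a} {b} {c} {p} {q} {u} {v} abc≈pq uq≈1 vb≈1 = begin
    a * u * c                      ≈⟨ *-identityʳ _ ⟨
    a * u * c * 1#                 ≈⟨ *-congˡ vb≈1 ⟨
    a * u * c * (v * b)
      ≈⟨ solve 5 (λ a u c v b → ((a ⊕ u) ⊕ c) ⊕ (v ⊕ b) ⊜ ((a ⊕ b) ⊕ c) ⊕ (u ⊕ v)) refl a u c v b ⟩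
    a * b * c * (u * v)            ≈⟨ *-congʳ abc≈pq ⟩
    p * q * (u * v)
      ≈⟨ solve 4 (λ p q u v → (p ⊕ q) ⊕ (u ⊕ v) ⊜ (p ⊕ v) ⊕ (u ⊕ q)) refl p q u v ⟩
    p * v * (u * q)                ≈⟨ *-congˡ uq≈1 ⟩
    p * v * 1#                     ≈⟨ *-identityʳ _ ⟩
    p * v                          ∎

  x*z≈x⇒x≈0 : IsChar0Domain R → ∀ {x z} → x * z ≈ x → ¬ z ≈ 1# → x ≈ 0#
  x*z≈x⇒x≈0 (no-zero-divisors , _) {x} {z} xz≈x z≉1 with no-zero-divisors x (z - 1#) x[z-1]≈0
    where
    x[z-1]≈0 : x * (z - 1#) ≈ 0#
    x[z-1]≈0 = begin
      x * (z - 1#)       ≈⟨ x[y-z]≈xy-xz x z 1# ⟩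
      x * z - x * 1#     ≈⟨ +-cong xz≈x (-‿cong (*-identityʳ x)) ⟩
      x - x              ≈⟨ -‿inverseʳ x ⟩
      0#                 ∎
  ... | inj₁ x≈0   = x≈0
  ... | inj₂ z-1≈0 = contradiction (x∙y⁻¹≈ε⇒x≈y z 1# z-1≈0) z≉1

  open import Algebra.Properties.CommutativeSemigroup *-commutativeSemigroup using (interchange)
  import Algebra.Properties.CommutativeSemigroup ℕ.+-commutativeSemigroup as ℕ+

  module RootOfUnity {h} .{{_ : NonZero h}} {ζ} (ζ^h≈1 : pow R ζ h ≈ 1#) where

    pow-*h : ∀ p → pow R ζ (p ℕ.* h) ≈ 1#
    pow-*h zero    = refl
    pow-*h (suc p) = begin
      pow R ζ (h ℕ.+ p ℕ.* h)          ≈⟨ pow-+ ζ h (p ℕ.* h) ⟩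
      pow R ζ h * pow R ζ (p ℕ.* h)    ≈⟨ *-cong ζ^h≈1 (pow-*h p) ⟩
      1# * 1#                          ≈⟨ *-identityˡ 1# ⟩
      1#                               ∎

    pow-% : ∀ m → pow R ζ (m % h) ≈ pow R ζ m
    pow-% m = begin
      pow R ζ (m % h)                                 ≈⟨ *-identityʳ _ ⟨
      pow R ζ (m % h) * 1#                            ≈⟨ *-congˡ (pow-*h (m ℕ./ h)) ⟨
      pow R ζ (m % h) * pow R ζ (m ℕ./ h ℕ.* h)       ≈⟨ pow-+ ζ (m % h) _ ⟨
      pow R ζ (m % h ℕ.+ m ℕ./ h ℕ.* h)               ≡⟨ ≡.cong (pow R ζ) (m≡m%n+[m/n]*n m h) ⟨
      pow R ζ m                                       ∎

    pow-mod : ∀ m → pow R ζ (toℕ (m mod h)) ≈ pow R ζ m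
    pow-mod m = trans (reflexive (≡.cong (pow R ζ) (toℕ-fromℕ< (m%n<n m h)))) (pow-% m)

    pow-inverse : ∀ {w} → w ℕ.≤ h → pow R ζ (h ∸ w) * pow R ζ w ≈ 1#
    pow-inverse {w} w≤h = begin
      pow R ζ (h ∸ w) * pow R ζ w      ≈⟨ pow-+ ζ (h ∸ w) w ⟨
      pow R ζ (h ∸ w ℕ.+ w)            ≡⟨ ≡.cong (pow R ζ) (ℕ.m∸n+n≡m w≤h) ⟩
      pow R ζ h                        ≈⟨ ζ^h≈1 ⟩
      1#                               ∎

    pow-%-relation : ∀ {a b c p q} → a ℕ.+ b ℕ.+ c ≡ p ℕ.+ q →
                     pow R ζ (a % h) * pow R ζ (b % h) * pow R ζ c ≈ pow R ζ (p % h) * pow R ζ (q % h)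
    pow-%-relation {a} {b} {c} {p} {q} a+b+c≡p+q = begin
      pow R ζ (a % h) * pow R ζ (b % h) * pow R ζ c    ≈⟨ *-congʳ (*-cong (pow-% a) (pow-% b)) ⟩
      pow R ζ a * pow R ζ b * pow R ζ c                ≈⟨ *-congʳ (pow-+ ζ a b) ⟨
      pow R ζ (a ℕ.+ b) * pow R ζ c                    ≈⟨ pow-+ ζ (a ℕ.+ b) c ⟨
      pow R ζ (a ℕ.+ b ℕ.+ c)                          ≡⟨ ≡.cong (pow R ζ) a+b+c≡p+q ⟩
      pow R ζ (p ℕ.+ q)                                ≈⟨ pow-+ ζ p q ⟩
      pow R ζ p * pow R ζ q                            ≈⟨ *-cong (pow-% p) (pow-% q) ⟨
      pow R ζ (p % h) * pow R ζ (q % h)                ∎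

    pow-inverse-mod-+ : ∀ {w₁ w₂} → w₁ ℕ.≤ h → w₂ ℕ.≤ h →
                        pow R ζ (h ∸ toℕ ((w₁ ℕ.+ w₂) mod h)) ≈ pow R ζ (h ∸ w₁) * pow R ζ (h ∸ w₂)
    pow-inverse-mod-+ {w₁} {w₂} w₁≤h w₂≤h = inverse-unique inverse-of-sum inverse-of-product
      where
      w = toℕ ((w₁ ℕ.+ w₂) mod h)
      inverse-of-sum : pow R ζ (h ∸ w) * (pow R ζ w₁ * pow R ζ w₂) ≈ 1#
      inverse-of-sum = begin
        pow R ζ (h ∸ w) * (pow R ζ w₁ * pow R ζ w₂)
          ≈⟨ *-congˡ (trans (pow-mod (w₁ ℕ.+ w₂)) (pow-+ ζ w₁ w₂)) ⟨
        pow R ζ (h ∸ w) * pow R ζ w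
          ≈⟨ pow-inverse (ℕ.<⇒≤ (toℕ<n ((w₁ ℕ.+ w₂) mod h))) ⟩
        1#                                            ∎
      inverse-of-product : pow R ζ (h ∸ w₁) * pow R ζ (h ∸ w₂) * (pow R ζ w₁ * pow R ζ w₂) ≈ 1#
      inverse-of-product = begin
        pow R ζ (h ∸ w₁) * pow R ζ (h ∸ w₂) * (pow R ζ w₁ * pow R ζ w₂)
          ≈⟨ interchange _ _ _ _ ⟩
        pow R ζ (h ∸ w₁) * pow R ζ w₁ * (pow R ζ (h ∸ w₂) * pow R ζ w₂)
          ≈⟨ *-cong (pow-inverse w₁≤h) (pow-inverse w₂≤h) ⟩
        1# * 1#
          ≈⟨ *-identityˡ 1# ⟩
        1#  ∎

    correlation-mod-+ : ∀ u₁ u₂ {w₁ w₂} → w₁ ℕ.≤ h → w₂ ℕ.≤ h →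
      pow R ζ (toℕ ((u₁ ℕ.+ u₂) mod h)) * pow R ζ (h ∸ toℕ ((w₁ ℕ.+ w₂) mod h))
        ≈ pow R ζ u₁ * pow R ζ (h ∸ w₁) * (pow R ζ u₂ * pow R ζ (h ∸ w₂))
    correlation-mod-+ u₁ u₂ w₁≤h w₂≤h =
      trans (*-cong (trans (pow-mod (u₁ ℕ.+ u₂)) (pow-+ ζ u₁ u₂)) (pow-inverse-mod-+ w₁≤h w₂≤h))
            (interchange _ _ _ _)

    autocorr-⊗ : ∀ {k} {n : Fin (suc k) → ℕ} (a : Fin (n zero) → Fin h)
                 (B : Array h k (λ i → n (suc i))) (s : Index (suc k) n) →
                 autocorr R h (suc k) n ζ (a ⊗ B) s
                   ≈ seqAutocorr R h (n zero) ζ a (s zero) * autocorr R h k (λ i → n (suc i)) ζ B (λ j → s (suc j))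
    autocorr-⊗ {k} {n} a B s = begin
      autocorr R h (suc k) n ζ (a ⊗ B) s
        ≈⟨ sumFin-cong (n zero) (λ x → sumIndex-cong k n′ (λ t →
             correlation-mod-+ (toℕ (a x)) (toℕ (B t))
               (ℕ.<⇒≤ (toℕ<n (a (x +ₘ s zero)))) (ℕ.<⇒≤ (toℕ<n (B (shift t s′)))))) ⟩
      sumFin R (n zero) (λ x → sumIndex R k n′ (λ t → corrA x * corrB t))
        ≈⟨ sumFin-cong (n zero) (λ x → sym (*-distribˡ-sumIndex k n′ (corrA x) corrB)) ⟩
      sumFin R (n zero) (λ x → corrA x * autocorr R h k n′ ζ B s′)
        ≈⟨ sym (*-distribʳ-sumFin (n zero) _ corrA) ⟩
      seqAutocorr R h (n zero) ζ a (s zero) * autocorr R h k n′ ζ B s′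
        ∎
      where
      n′ : Fin k → ℕ
      n′ i = n (suc i)
      s′ : Index k n′
      s′ j = s (suc j)
      corrA : Fin (n zero) → Carrier
      corrA x = pow R ζ (toℕ (a x)) * pow R ζ (h ∸ toℕ (a (x +ₘ s zero)))
      corrB : Index k n′ → Carrier
      corrB t = pow R ζ (toℕ (B t)) * pow R ζ (h ∸ toℕ (B (shift t s′)))

  primitive-pow≉1 : ∀ {h ζ} .{{_ : NonZero h}} → IsPrimitiveRoot R h ζ → ∀ {d} → ¬ h ∣ d → ¬ pow R ζ d ≈ 1#
  primitive-pow≉1 {h} (ζ^h≈1 , minimal) {d} h∤d ζ^d≈1 =
    minimal (d % h) (ℕ.n≢0⇒n>0 (h∤d ∘ m%n≡0⇒n∣m d h)) (m%n<n d h) (trans (pow-% d) ζ^d≈1)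
    where open RootOfUnity ζ^h≈1

  exponentSequence-autocorr : ∀ {N h} .{{_ : NonZero N}} .{{_ : NonZero h}} (E : PerfectExponent N h) →
    IsChar0Domain R → ∀ {ζ} → IsPrimitiveRoot R h ζ →
    ∀ σ → toℕ σ ≢ 0 → seqAutocorr R h N ζ (exponentSequence E) σ ≈ 0#
  exponentSequence-autocorr {N} {h} E dom {ζ} prim σ σ≢0 =
    x*z≈x⇒x≈0 dom S*ζᵈ≈S (primitive-pow≉1 prim defect-indivisible)
    where
    open PerfectExponent E
    open Cancellation (cancellation (ℕ.n≢0⇒n>0 σ≢0) (toℕ<n σ))
    open RootOfUnity (proj₁ prim)

    s = toℕ σ

    ê : ℕ → ℕ
    ê y = exponent y % h

    ê-periodic : ∀ y → ê (y ℕ.+ N) ≡ ê y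
    ê-periodic y = ≡.trans (≡.cong (_% h) (proj₂ (periodic y))) ([m+kn]%n≡m%n (exponent y) (proj₁ (periodic y)) h)

    q : ℕ → Carrier
    q y = pow R ζ (ê y) * pow R ζ (h ∸ ê (y ℕ.+ s))

    q-periodic : ∀ y → q (y ℕ.+ N) ≈ q y
    q-periodic y = reflexive (≡.cong₂ (λ u w → pow R ζ u * pow R ζ (h ∸ w))
      (ê-periodic y) (≡.trans (≡.cong ê (ℕ+.xy∙z≈xz∙y y N s)) (ê-periodic (y ℕ.+ s))))

    q-shift : ∀ y → q (y ℕ.+ offset) * pow R ζ defect ≈ q y
    q-shift y = inverse-exchange (pow-%-relation exponents-relation) (pow-inverse (m%n≤n _ h)) (pow-inverse (m%n≤n _ h))
      where
      exponents-relation : exponent (y ℕ.+ offset) ℕ.+ exponent (y ℕ.+ s) ℕ.+ defect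
                           ≡ exponent y ℕ.+ exponent (y ℕ.+ offset ℕ.+ s)
      exponents-relation =
        ≡.trans (identity y) (≡.cong (λ z → exponent y ℕ.+ exponent z) (ℕ+.xy∙z≈xz∙y y s offset))

    S = seqAutocorr R h N ζ (exponentSequence E) σ
    Q = sumFin R N (λ x → q (toℕ x))

    S≈Q : S ≈ Q
    S≈Q = sumFin-cong N (λ x → reflexive (≡.cong₂ (λ u w → pow R ζ u * pow R ζ (h ∸ w))
      (toℕ-fromℕ< (m%n<n (exponent (toℕ x)) h))
      (≡.trans (toℕ-fromℕ< (m%n<n (exponent (toℕ (x +ₘ σ))) h))
        (≡.trans (≡.cong ê (toℕ-+ₘ x σ)) (periodic-% ê ê-periodic (toℕ x ℕ.+ s))))))

    S*ζᵈ≈S : S * pow R ζ defect ≈ S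
    S*ζᵈ≈S = trans (*-congʳ S≈Q) (trans (sumFin-*-fixed N q offset q-periodic q-shift) (sym S≈Q))

perfectSequence : ∀ {N h} .{{_ : NonZero N}} .{{_ : NonZero h}} →
                  N ∣ gcd h N ^ 2 → ¬ (ν₂ N ≡ 1 × ν₂ h ≡ 1) → Σ (Fin N → Fin h) (IsPerfectSequence h N)
perfectSequence N∣gcd² ν₂≢1 =
  exponentSequence E , λ R dom ζ prim → Correlation.exponentSequence-autocorr R E dom prim
  where
  E = perfectExponent N∣gcd² ν₂≢1

⊗-perfect : ∀ {h k} .{{_ : NonZero h}} {n : Fin (suc k) → ℕ} a B →
            IsPerfectSequence h (n zero) a → IsPerfect h k (λ i → n (suc i)) B → IsPerfect h (suc k) n (a ⊗ B)
⊗-perfect {h} {k} {n} a B a-perfect B-perfect R dom ζ prim s s≢0 =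
  trans (autocorr-⊗ a B s) (factor≈0 (toℕ (s zero) ℕ.≟ 0))
  where
  open CommutativeRing R using (_≈_; _*_; 0#; trans; *-congˡ; *-congʳ; zeroˡ; zeroʳ)
  open Correlation.RootOfUnity R (proj₁ prim) using (autocorr-⊗)
  factor≈0 : Dec (toℕ (s zero) ≡ 0) →
             seqAutocorr R h (n zero) ζ a (s zero) * autocorr R h k (λ i → n (suc i)) ζ B (λ j → s (suc j)) ≈ 0#
  factor≈0 (yes s₀≡0) = trans (*-congˡ (B-perfect R dom ζ prim (λ j → s (suc j)) s′≢0)) (zeroʳ _)
    where
    s′≢0 : ¬ IsZeroShift (λ j → s (suc j))
    s′≢0 s′≡0 = s≢0 λ { zero → s₀≡0 ; (suc j) → s′≡0 j }
  factor≈0 (no s₀≢0)  = trans (*-congʳ (a-perfect R dom ζ prim (s zero) s₀≢0)) (zeroˡ _)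

perfectArray : ∀ {h} .{{_ : NonZero h}} k (n : Fin k → ℕ) →
               (∀ i → Σ (Fin (n i) → Fin h) (IsPerfectSequence h (n i))) → Σ (Array h k n) (IsPerfect h k n)
perfectArray zero    n _ = (λ _ → 0 mod _) , λ R dom ζ prim s s≢0 → contradiction (λ ()) s≢0
perfectArray (suc k) n sequences with sequences zero | perfectArray k (λ i → n (suc i)) (λ i → sequences (suc i))
... | a , a-perfect | B , B-perfect = a ⊗ B , ⊗-perfect a B a-perfect B-perfect

theorem4p4 : (k h : ℕ) (n : Fin k → ℕ) →
    1 ≤ k → 1 ≤ h → (∀ i → 1 ≤ n i) →
    (∀ i → n i ∣ gcd h (n i) ^ 2) →
    (∀ i → ¬ (ν₂ (n i) ≡ 1 × ν₂ h ≡ 1)) →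
    Σ (Array h k n) (λ A → IsPerfect h k n A)
theorem4p4 k h n _ h≥1 n≥1 n∣gcd² ν₂≢1 =
  perfectArray k n (λ i → perfectSequence {{ℕ.>-nonZero (n≥1 i)}} (n∣gcd² i) (ν₂≢1 i))
  where
  instance
    h≢0 : NonZero h
    h≢0 = ℕ.>-nonZero h≥1
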